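{- Let $\mathbf{T}$ be the dappled triangular grid. For any vertex $v$ of $\mathbf{T}$, if $u_1$ and $u_2$ are distinct neighbors of $v$, then $(\psi_\mathbf{T}(u_1),\varphi_\mathbf{T}(u_1))\neq(\psi_\mathbf{T}(u_2),\varphi_\mathbf{T}(u_2))$. Consequently, for any connected dappled graph $G$ and any vertex $x\in V(G)$, if $f_1,f_2:V(G)\to V(\mathbf{T})$ are homomorphisms of dappled graphs with $f_1(x)=f_2(x)$, then $f_1=f_2$.
   Context: A hued graph is a graph $G$ together with a proper 3-coloring $\psi_G:V(G)\to\mathbb{Z}_3$ (the hue). A dappled graph is a hued graph $G$ together with a proper 4-coloring $\varphi_G:V(G)\to\mathbb{Z}_2^2$ (the color). A homomorphism of dappled graphs $f:V(G)\to V(H)$ satisfies $f(u)f(v)\in E(H)$ for every $uv\in E(G)$, and $\psi_H(f(v))=\psi_G(v)$ and $\varphi_H(f(v))=\varphi_G(v)$ for every $v\in V(G)$. The dappled triangular grid $\mathbf{T}$ is the infinite dappled graph with vertex set $\mathbb{Z}^2$, where $(i_1,j_1)$ and $(i_2,j_2)$ are adjacent iff $(i_2-i_1,j_2-j_1)\in\{\pm(1,0),\pm(0,1),\pm(1,1)\}$, with hue $\psi_\mathbf{T}(i,j)=(i+j)\bmod 3$ and color $\varphi_\mathbf{T}(i,j)=(i\bmod 2,j\bmod 2)$. -}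

module Defs where

open import Level using (Level; _⊔_; suc)
open import Data.Nat using (ℕ; NonZero)
open import Data.Integer using (ℤ; +_; -[1+_]; _+_; _-_; _%ℕ_)
open import Data.Integer.DivMod using (n%ℕd<d)
open import Data.Fin using (Fin; fromℕ<)
open import Data.Product using (_×_; _,_)
open import Data.Sum using (_⊎_)
open import Data.Empty using (⊥)
open import Relation.Binary.PropositionalEquality using (_≡_; _≢_)
open import Relation.Binary.Construct.Closure.ReflexiveTransitive using (Star)

-- ℤ₃ and ℤ₂² represented by Fin 3 and Fin 2 × Fin 2.
Hue : Set
Hue = Fin 3

Color : Set
Color = Fin 2 × Fin 2

record DappledData (a ℓ : Level) : Set (Level.suc (a ⊔ ℓ)) where
  field
    V   : Set a
    E   : V → V → Set ℓ
    hue : V → Hue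
    col : V → Color
open DappledData public

record IsDappled {a ℓ : Level} (G : DappledData a ℓ) : Set (a ⊔ ℓ) where
  field
    E-sym     : ∀ {u v} → E G u v → E G v u
    E-irrefl  : ∀ {u} → E G u u → ⊥
    hue-proper : ∀ {u v} → E G u v → hue G u ≢ hue G v
    col-proper : ∀ {u v} → E G u v → col G u ≢ col G v

Connected : {a ℓ : Level} → DappledData a ℓ → Set (a ⊔ ℓ)
Connected G = ∀ u v → Star (E G) u v

record IsHom {a ℓ b m : Level} (G : DappledData a ℓ) (H : DappledData b m)
             (f : V G → V H) : Set (a ⊔ ℓ ⊔ m) where
  field
    edge : ∀ {u v} → E G u v → E H (f u) (f v)
    hue≡ : ∀ v → hue H (f v) ≡ hue G v
    col≡ : ∀ v → col H (f v) ≡ col G v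

_mod′_ : ℤ → (k : ℕ) → .{{NonZero k}} → Fin k
n mod′ k = fromℕ< (n%ℕd<d n k)

TAdj : ℤ × ℤ → ℤ × ℤ → Set
TAdj (i₁ , j₁) (i₂ , j₂) =
  let d = (i₂ - i₁ , j₂ - j₁) in
  (d ≡ (+ 1 , + 0)) ⊎ (d ≡ (-[1+ 0 ] , + 0)) ⊎
  (d ≡ (+ 0 , + 1)) ⊎ (d ≡ (+ 0 , -[1+ 0 ])) ⊎
  (d ≡ (+ 1 , + 1)) ⊎ (d ≡ (-[1+ 0 ] , -[1+ 0 ]))

T : DappledData Level.zero Level.zero
V T = ℤ × ℤ
E T = TAdj
hue T (i , j) = (i + j) mod′ 3
col T (i , j) = (i mod′ 2 , j mod′ 2)

{-# OPTIONS --safe #-}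
-- Hue and color only see the residues of i + j mod 3, i mod 2 and j mod 2, so two vertices carry
-- the same labels iff their difference lies in the lattice of label periods {(i , j) : 3 ∣ i + j,
-- 2 ∣ i, 2 ∣ j}.  No difference of two of the six neighbour offsets is a nonzero period, hence the
-- neighbours of a vertex are told apart by their labels.  A homomorphism into T is then determined,
-- edge by edge along a walk, by its value at one vertex.
module Submission where

open import Defs
open import Level using (Level; _⊔_)
open import Data.Nat using (NonZero)
open import Data.Integer using (ℤ; +_; -[1+_]; _+_; _-_; _*_; _%ℕ_; _/ℕ_)
open import Data.Integer.DivMod using (a≡a%ℕn+[a/ℕn]*n)
open import Data.Integer.Divisibility.Signed using (_∣_; divides; _∣?_; ∣m∣n⇒∣m-n)
open import Data.Integer.Properties using (_≟_; +-0-abelianGroup)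
open import Data.Integer.Tactic.RingSolver using (solve-∀)
open import Algebra.Bundles using (AbelianGroup)
open import Algebra.Properties.Group (AbelianGroup.group +-0-abelianGroup) using (∙-cancelʳ)
open import Data.Fin using (toℕ)
open import Data.Fin.Properties using (toℕ-fromℕ<)
open import Data.List using (List; []; _∷_)
open import Data.List.Membership.Propositional using (_∈_)
open import Data.List.Relation.Unary.Any using (here; there)
open import Data.List.Relation.Unary.All using (All; all?; lookup)
open import Data.Product using (_×_; _,_; proj₁; proj₂)
open import Data.Product.Properties using (≡-dec)
open import Data.Sum using (inj₁; inj₂)
open import Relation.Nullary.Decidable using (Dec; toWitness; _×-dec_; _→-dec_)
open import Relation.Binary.PropositionalEquality
  using (_≡_; _≢_; sym; trans; cong; cong₂; subst; module ≡-Reasoning)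
open import Relation.Binary.Construct.Closure.ReflexiveTransitive using (Star; ε; _◅_)

residue-divides : ∀ x k .{{_ : NonZero k}} → + k ∣ x - + (x %ℕ k)
residue-divides x k = divides (x /ℕ k) (begin
  x - r                         ≡⟨ cong (_- r) (a≡a%ℕn+[a/ℕn]*n x k) ⟩
  (r + (x /ℕ k) * + k) - r      ≡⟨ [r+s]-r≡s r ((x /ℕ k) * + k) ⟩
  (x /ℕ k) * + k                ∎)
  where
  open ≡-Reasoning
  r : ℤ
  r = + (x %ℕ k)
  [r+s]-r≡s : ∀ r s → (r + s) - r ≡ s
  [r+s]-r≡s = solve-∀

[x-r]-[y-r]≡x-y : ∀ x y r → (x - r) - (y - r) ≡ x - y
[x-r]-[y-r]≡x-y = solve-∀

mod′-≡⇒∣- : ∀ x y k .{{_ : NonZero k}} → x mod′ k ≡ y mod′ k → + k ∣ x - y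
mod′-≡⇒∣- x y k eq =
  subst (+ k ∣_) ([x-r]-[y-r]≡x-y x y (+ (x %ℕ k)))
    (subst (λ s → + k ∣ (x - + (x %ℕ k)) - (y - + s)) (sym same-residue)
      (∣m∣n⇒∣m-n (residue-divides x k) (residue-divides y k)))
  where
  same-residue : x %ℕ k ≡ y %ℕ k
  same-residue = trans (sym (toℕ-fromℕ< _)) (trans (cong toℕ eq) (toℕ-fromℕ< _))

_⊖_ : ℤ × ℤ → ℤ × ℤ → ℤ × ℤ
(i₁ , j₁) ⊖ (i₂ , j₂) = (i₁ - i₂ , j₁ - j₂)

⊖-cancelʳ : ∀ u w v → u ⊖ v ≡ w ⊖ v → u ≡ w
⊖-cancelʳ (a , b) (c , d) (i , j) eq =
  cong₂ _,_ (∙-cancelʳ _ a c (cong proj₁ eq)) (∙-cancelʳ _ b d (cong proj₂ eq))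

[u⊖v]⊖[w⊖v]≡u⊖w : ∀ u w v → (u ⊖ v) ⊖ (w ⊖ v) ≡ u ⊖ w
[u⊖v]⊖[w⊖v]≡u⊖w (a , b) (c , d) (i , j) = cong₂ _,_ ([x-r]-[y-r]≡x-y a c i) ([x-r]-[y-r]≡x-y b d j)

LabelPeriod : ℤ × ℤ → Set
LabelPeriod (i , j) = + 3 ∣ i + j × + 2 ∣ i × + 2 ∣ j

labelPeriod? : ∀ z → Dec (LabelPeriod z)
labelPeriod? (i , j) = (+ 3 ∣? i + j) ×-dec (+ 2 ∣? i) ×-dec (+ 2 ∣? j)

sameLabels⇒labelPeriod : ∀ u w → hue T u ≡ hue T w → col T u ≡ col T w → LabelPeriod (u ⊖ w)
sameLabels⇒labelPeriod (a , b) (c , d) same-hue same-col =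
    subst (+ 3 ∣_) (regroup a b c d) (mod′-≡⇒∣- (a + b) (c + d) 3 same-hue)
  , mod′-≡⇒∣- a c 2 (cong proj₁ same-col)
  , mod′-≡⇒∣- b d 2 (cong proj₂ same-col)
  where
  regroup : ∀ a b c d → (a + b) - (c + d) ≡ (a - c) + (b - d)
  regroup = solve-∀

offsets : List (ℤ × ℤ)
offsets = (+ 1 , + 0) ∷ (-[1+ 0 ] , + 0) ∷ (+ 0 , + 1) ∷ (+ 0 , -[1+ 0 ])
        ∷ (+ 1 , + 1) ∷ (-[1+ 0 ] , -[1+ 0 ]) ∷ []

TAdj⇒⊖∈offsets : ∀ v u → TAdj v u → u ⊖ v ∈ offsets
TAdj⇒⊖∈offsets (i , j) (a , b) (inj₁ d) = here d
TAdj⇒⊖∈offsets (i , j) (a , b) (inj₂ (inj₁ d)) = there (here d)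
TAdj⇒⊖∈offsets (i , j) (a , b) (inj₂ (inj₂ (inj₁ d))) = there (there (here d))
TAdj⇒⊖∈offsets (i , j) (a , b) (inj₂ (inj₂ (inj₂ (inj₁ d)))) = there (there (there (here d)))
TAdj⇒⊖∈offsets (i , j) (a , b) (inj₂ (inj₂ (inj₂ (inj₂ (inj₁ d))))) =
  there (there (there (there (here d))))
TAdj⇒⊖∈offsets (i , j) (a , b) (inj₂ (inj₂ (inj₂ (inj₂ (inj₂ d))))) =
  there (there (there (there (there (here d)))))

offsets-separated-by-labelPeriods :
  All (λ d₁ → All (λ d₂ → LabelPeriod (d₁ ⊖ d₂) → d₁ ≡ d₂) offsets) offsets
offsets-separated-by-labelPeriods = toWitness {a? = all? (λ d₁ → all? (λ d₂ →
  labelPeriod? (d₁ ⊖ d₂) →-dec ≡-dec _≟_ _≟_ d₁ d₂) offsets) offsets} _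

NeighboursSeparatedByLabels : ∀ {a ℓ} → DappledData a ℓ → Set (a ⊔ ℓ)
NeighboursSeparatedByLabels H = ∀ {v u₁ u₂} → E H v u₁ → E H v u₂ →
  hue H u₁ ≡ hue H u₂ → col H u₁ ≡ col H u₂ → u₁ ≡ u₂

T-neighboursSeparatedByLabels : NeighboursSeparatedByLabels T
T-neighboursSeparatedByLabels {v} {u₁} {u₂} vu₁ vu₂ same-hue same-col =
  ⊖-cancelʳ u₁ u₂ v (lookup (lookup offsets-separated-by-labelPeriods (TAdj⇒⊖∈offsets v u₁ vu₁))
    (TAdj⇒⊖∈offsets v u₂ vu₂) period)
  where
  period : LabelPeriod ((u₁ ⊖ v) ⊖ (u₂ ⊖ v))
  period = subst LabelPeriod (sym ([u⊖v]⊖[w⊖v]≡u⊖w u₁ u₂ v))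
    (sameLabels⇒labelPeriod u₁ u₂ same-hue same-col)

homs-agree-along-walk : ∀ {a ℓ b m} {G : DappledData a ℓ} {H : DappledData b m} →
  NeighboursSeparatedByLabels H → ∀ {f₁ f₂ : V G → V H} → IsHom G H f₁ → IsHom G H f₂ →
  ∀ {x v} → Star (E G) x v → f₁ x ≡ f₂ x → f₁ v ≡ f₂ v
homs-agree-along-walk separated h₁ h₂ ε eq = eq
homs-agree-along-walk {H = H} separated {f₁} {f₂} h₁ h₂ (_◅_ {j = y} xy walk) eq =
  homs-agree-along-walk separated h₁ h₂ walk
    (separated (IsHom.edge h₁ xy) (subst (λ z → E H z (f₂ y)) (sym eq) (IsHom.edge h₂ xy))
      (trans (IsHom.hue≡ h₁ y) (sym (IsHom.hue≡ h₂ y)))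
      (trans (IsHom.col≡ h₁ y) (sym (IsHom.col≡ h₂ y))))

mainTheorem3 : ∀ {a ℓ : Level} →
    (∀ (v u₁ u₂ : V T) → E T v u₁ → E T v u₂ → u₁ ≢ u₂ →
       (hue T u₁ , col T u₁) ≢ (hue T u₂ , col T u₂))
    ×
    (∀ (G : DappledData a ℓ) → IsDappled G → Connected G →
       (x : V G) (f₁ f₂ : V G → V T) → IsHom G T f₁ → IsHom G T f₂ →
       f₁ x ≡ f₂ x → ∀ v → f₁ v ≡ f₂ v)
mainTheorem3 =
    (λ v u₁ u₂ vu₁ vu₂ u₁≢u₂ same-labels →
       u₁≢u₂ (T-neighboursSeparatedByLabels vu₁ vu₂ (cong proj₁ same-labels) (cong proj₂ same-labels)))
  , λ G _ connected x f₁ f₂ h₁ h₂ eq v →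
       homs-agree-along-walk T-neighboursSeparatedByLabels h₁ h₂ (connected x v) eq
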